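{- Let $G$ be a vertex-colored graph and $T$ a colorful tree, and let $H = \textsc{mcg}(G,T)$. Then $H$ is the maximum clean subgraph of $G$ regarding $T$; that is, every vertex and every edge of $H$ belongs to some subgraph of $H$ color-isomorphic to $T$, and every subgraph of $G$ color-isomorphic to $T$ is a subgraph of $H$.
   Context: A vertex-colored graph is a finite simple undirected graph with a color function $c$ on its vertices; it is colorful if $c$ is injective on its vertices. A color-isomorphism is a graph isomorphism preserving vertex colors. A graph $H$ is a clean subgraph regarding $T$ if each vertex and each edge of $H$ is a vertex, respectively an edge, of a subgraph of $H$ color-isomorphic to $T$; $H \subseteq G$ is the maximum clean subgraph of $G$ regarding $T$ if it is clean regarding $T$ and every subgraph of $G$ color-isomorphic to $T$ is a subgraph of $H$. Algorithm \textsc{mcg}$(G,T)$: set $H := G$; delete from $H$ every vertex whose color is not the color of some vertex of $T$; delete from $H$ every edge $vv'$ for which there is no edge $ww' \in E_T$ with $c(v) = c(w)$ and $c(v') = c(w')$; then, while there exist $v \in V_H$ and $w, w' \in V_T$ with $c(v) = c(w)$, $ww' \in E_T$, such that no $v' \in V_H$ satisfies $vv' \in E_H$ and $c(v') = c(w')$, delete $v$ (and its incident edges) from $H$; finally return $H$. -}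

module Defs where

open import Data.Nat using (ℕ; _≤_)
open import Data.Fin using (Fin; _≟_)
open import Data.Fin.Properties using (any?)
open import Data.Bool using (Bool; true; false; _∧_; not)
open import Data.Bool.Properties renaming (_≟_ to _≟ᵇ_)
open import Data.List using (List; []; _∷_; _++_; [_]; length)
open import Data.List.Relation.Unary.Linked using (Linked)
open import Data.List.Relation.Unary.Unique.Propositional using (Unique)
open import Data.Product using (Σ; ∃; _×_; _,_)
open import Data.Empty using (⊥)
open import Function using (Injective)
open import Relation.Nullary using (¬_)
open import Relation.Nullary.Decidable using (⌊_⌋; _×-dec_)
open import Relation.Binary using (DecidableEquality)
open import Relation.Binary.PropositionalEquality using (_≡_)
open import Relation.Binary.Construct.Closure.ReflexiveTransitive using (Star)

record Graph (C : Set) : Set where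
  field
    n      : ℕ
    col    : Fin n → C
    adj    : Fin n → Fin n → Bool
    sym    : ∀ u v → adj u v ≡ adj v u
    irrefl : ∀ v → adj v v ≡ false
open Graph public

E : ∀ {C} (G : Graph C) → Fin (n G) → Fin (n G) → Set
E G u v = adj G u v ≡ true

Colorful : ∀ {C} → Graph C → Set
Colorful T = Injective _≡_ _≡_ (col T)

Connected : ∀ {C} → Graph C → Set
Connected G = ∀ u v → Star (E G) u v

-- a cycle: distinct vertices x, x1, ..., xk (k ≥ 2, so at least 3 vertices),
-- consecutive ones adjacent, and xk adjacent to x
HasCycle : ∀ {C} → Graph C → Set
HasCycle G = Σ (Fin (n G)) λ x → Σ (List (Fin (n G))) λ xs →
  Unique (x ∷ xs) × 2 ≤ length xs × Linked (E G) (x ∷ xs ++ [ x ])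

IsTree : ∀ {C} → Graph C → Set
IsTree G = Connected G × ¬ HasCycle G

-- (Candidate) subgraphs of G: a vertex set and an edge set, as Bool predicates.

record Sub {C} (G : Graph C) : Set where
  constructor sub
  field
    vs : Fin (n G) → Bool
    es : Fin (n G) → Fin (n G) → Bool
open Sub public

IsSubgraph : ∀ {C} (G : Graph C) → Sub G → Set
IsSubgraph G S =
  (∀ u v → es S u v ≡ true → adj G u v ≡ true) ×
  (∀ u v → es S u v ≡ es S v u) ×
  (∀ u v → es S u v ≡ true → vs S u ≡ true × vs S v ≡ true)

_⊆ₛ_ : ∀ {C} {G : Graph C} → Sub G → Sub G → Set
S ⊆ₛ H = (∀ v → vs S v ≡ true → vs H v ≡ true) ×
         (∀ u v → es S u v ≡ true → es H u v ≡ true)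

record ColorIso {C} (G : Graph C) (S : Sub G) (T : Graph C) : Set where
  field
    to      : Fin (n T) → Fin (n G)
    to-in   : ∀ w → vs S (to w) ≡ true
    from    : (v : Fin (n G)) → vs S v ≡ true → Fin (n T)
    from-to : ∀ w → from (to w) (to-in w) ≡ w
    to-from : ∀ v (p : vs S v ≡ true) → to (from v p) ≡ v
    col-pres : ∀ w → col G (to w) ≡ col T w
    adj-pres : ∀ w w' → es S (to w) (to w') ≡ adj T w w'

IsCopy : ∀ {C} (G : Graph C) (T : Graph C) → Sub G → Set
IsCopy G T S = IsSubgraph G S × ColorIso G S T

Clean : ∀ {C} (G : Graph C) (T : Graph C) → Sub G → Set
Clean G T H =
  (∀ v → vs H v ≡ true →
     Σ (Sub G) λ S → IsCopy G T S × S ⊆ₛ H × vs S v ≡ true) ×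
  (∀ u v → es H u v ≡ true →
     Σ (Sub G) λ S → IsCopy G T S × S ⊆ₛ H × es S u v ≡ true)

MaxClean : ∀ {C} (G : Graph C) (T : Graph C) → Sub G → Set
MaxClean G T H =
  IsSubgraph G H × Clean G T H ×
  (∀ S → IsCopy G T S → S ⊆ₛ H)

-- Algorithm mcg(G, T), with the nondeterministic while-loop described
-- as a relation (any order of deletions is allowed).

module _ {C : Set} (_≟C_ : DecidableEquality C) (G T : Graph C) where

  pruneV : Fin (n G) → Bool
  pruneV v = ⌊ any? (λ w → col G v ≟C col T w) ⌋

  prune : Sub G
  prune = sub pruneV
    (λ v v' → adj G v v' ∧ pruneV v ∧ pruneV v' ∧
       ⌊ any? (λ w → any? (λ w' →
            (adj T w w' ≟ᵇ true) ×-dec (col G v ≟C col T w) ×-dec (col G v' ≟C col T w'))) ⌋)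

  delete : Sub G → Fin (n G) → Sub G
  delete H v = sub (λ u → vs H u ∧ not ⌊ u ≟ v ⌋)
                   (λ u u' → es H u u' ∧ not ⌊ u ≟ v ⌋ ∧ not ⌊ u' ≟ v ⌋)

  Removable : Sub G → Fin (n G) → Set
  Removable H v = vs H v ≡ true × Σ (Fin (n T)) λ w → Σ (Fin (n T)) λ w' →
    col G v ≡ col T w × adj T w w' ≡ true ×
    (∀ v' → vs H v' ≡ true → es H v v' ≡ true → col G v' ≡ col T w' → ⊥)

  Step : Sub G → Sub G → Set
  Step H H' = Σ (Fin (n G)) λ v → Removable H v × H' ≡ delete H v

  MCG : Sub G → Set
  MCG H = Star Step prune H × (∀ v → ¬ Removable H v)

-- Deleting a removable vertex v never destroys a copy of T: by colourfulness v could only be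
-- the image of the T-vertex w of its colour, and the image of the T-neighbour w′ of w would be a
-- neighbour of v of colour c(w′), which removability excludes. So every copy survives to the
-- output H. Conversely, when no vertex is removable, every vertex of H coloured like a T-vertex
-- a has, for each T-neighbour b of a, an H-neighbour coloured like b. Rooting T at r, every
-- vertex of T has a unique non-backtracking walk to r; mapping these walks into H step by step,
-- starting at a vertex u of H coloured like r, gives a colour-preserving homomorphism from T
-- into H through u (and, choosing neighbours suitably, through any given edge at u), whose image
-- is a copy of T because T is colourful. Acyclicity enters through the uniqueness of the walks:
-- for every edge ab of T, the walk from one endpoint is the walk from the other plus one step.

module Submission where

open import Defs
open import Algebra.Bundles using (CommutativeMonoid)
open import Data.Bool using (true; false; _∧_; not)
open import Data.Bool.Properties using (∧-comm; ∧-conicalˡ; ∧-conicalʳ; ∧-commutativeMonoid)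
  renaming (_≟_ to _≟ᵇ_)
open import Data.Empty using (⊥-elim)
open import Data.Fin using (Fin; _≟_)
open import Data.Fin.Properties using (any?)
open import Data.List using (List; []; _∷_; _++_; [_]; last; _ʳ++_)
open import Data.List.Membership.DecPropositional using (_∈?_)
open import Data.List.Membership.Propositional using (_∈_)
open import Data.List.Membership.Propositional.Properties using (∈-∃++)
open import Data.List.Relation.Unary.All using ([]; _∷_)
import Data.List.Relation.Unary.All.Properties as All
open import Data.List.Relation.Unary.Any using (here; there)
open import Data.List.Relation.Unary.Linked as Linked using (Linked; []; [-]; _∷_)
open import Data.List.Relation.Unary.Unique.DecPropositional using (unique?)
open import Data.List.Relation.Unary.Unique.Propositional using (Unique; []; _∷_)
open import Data.Maybe using (just)
open import Data.Nat using (s≤s; z≤n)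
open import Data.Product using (Σ; ∃; ∃₂; _×_; _,_; proj₁; proj₂)
open import Data.Sum using (_⊎_; inj₁; inj₂)
open import Data.Unit using (⊤; tt)
open import Function using (Injective; _⇔_; mk⇔)
open import Relation.Binary using (DecidableEquality)
open import Relation.Binary.Construct.Closure.ReflexiveTransitive using (Star; ε; _◅_)
open import Relation.Binary.PropositionalEquality as ≡
  using (_≡_; _≢_; refl; trans; cong; cong₂; subst; subst₂; ≢-sym)
open import Relation.Nullary using (¬_; Dec; yes; no; contradiction)
open import Relation.Nullary.Decidable using (⌊_⌋; _×-dec_; isYes≗does; does-⇔)

open import Algebra.Properties.CommutativeSemigroup
  (CommutativeMonoid.commutativeSemigroup ∧-commutativeMonoid) using (x∙yz≈y∙xz)

private variable
  A B : Set

⌊⌋-true⁻ : (a? : Dec A) → ⌊ a? ⌋ ≡ true → A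
⌊⌋-true⁻ (yes a) _ = a

⌊⌋-true⁺ : (a? : Dec A) → A → ⌊ a? ⌋ ≡ true
⌊⌋-true⁺ (yes _) _ = refl
⌊⌋-true⁺ (no ¬a) a = contradiction a ¬a

⌊⌋-false⁺ : (a? : Dec A) → ¬ A → ⌊ a? ⌋ ≡ false
⌊⌋-false⁺ (yes a) ¬a = contradiction a ¬a
⌊⌋-false⁺ (no _) _ = refl

⌊⌋-⇔ : A ⇔ B → (a? : Dec A) (b? : Dec B) → ⌊ a? ⌋ ≡ ⌊ b? ⌋
⌊⌋-⇔ A⇔B a? b? = trans (isYes≗does a?) (trans (does-⇔ A⇔B a? b?) (≡.sym (isYes≗does b?)))

∧-true⁻ : ∀ x {y} → x ∧ y ≡ true → x ≡ true × y ≡ true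
∧-true⁻ x {y} p = ∧-conicalˡ x y p , ∧-conicalʳ x y p

∧-true⁺ : ∀ {x y} → x ≡ true → y ≡ true → x ∧ y ≡ true
∧-true⁺ refl refl = refl

last-∈ : ∀ {x} (xs : List A) → last xs ≡ just x → x ∈ xs
last-∈ (_ ∷ []) refl = here refl
last-∈ (_ ∷ y ∷ xs) p = there (last-∈ (y ∷ xs) p)

∈⇒¬Unique-∷ : ∀ {x : A} {xs} → x ∈ xs → ¬ Unique (x ∷ xs)
∈⇒¬Unique-∷ x∈xs (x∉xs ∷ _) = All.All¬⇒¬Any x∉xs x∈xs

Unique-++-∷⁻ : ∀ (ys : List A) {x zs} → Unique (ys ++ x ∷ zs) → Unique (x ∷ ys)
Unique-++-∷⁻ [] _ = [] ∷ []
Unique-++-∷⁻ (y ∷ ys) (y∉ ∷ u) with Unique-++-∷⁻ ys u | All.++⁻ ys y∉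
... | x∉ys ∷ ys-unique | y∉ys , y≢x ∷ _ = (≢-sym y≢x ∷ x∉ys) ∷ (y∉ys ∷ ys-unique)

Linked-++-∷⁻ : ∀ {R : A → A → Set} {x} ys {y zs} →
  Linked R (x ∷ ys ++ y ∷ zs) → Linked R (x ∷ ys ++ [ y ])
Linked-++-∷⁻ [] (r ∷ _) = r ∷ [-]
Linked-++-∷⁻ (_ ∷ ys) (r ∷ rs) = r ∷ Linked-++-∷⁻ ys rs

ʳ++-Unique⁻ʳ : ∀ (xs : List A) {ys} → Unique (xs ʳ++ ys) → Unique ys
ʳ++-Unique⁻ʳ [] u = u
ʳ++-Unique⁻ʳ (x ∷ xs) u with ʳ++-Unique⁻ʳ xs u
... | _ ∷ ys-unique = ys-unique

ʳ++-common⇒¬Unique : ∀ (xs : List A) {ys y} → y ∈ xs → y ∈ ys → ¬ Unique (xs ʳ++ ys)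
ʳ++-common⇒¬Unique (x ∷ xs) (here refl) y∈ys u = ∈⇒¬Unique-∷ y∈ys (ʳ++-Unique⁻ʳ xs u)
ʳ++-common⇒¬Unique (x ∷ xs) (there y∈xs) y∈ys = ʳ++-common⇒¬Unique xs y∈xs (there y∈ys)

module ReducedWalks {C : Set} (T : Graph C) where

  private
    V : Set
    V = Fin (n T)

  E-sym : ∀ {a b} → E T a b → E T b a
  E-sym {a} {b} e = trans (Graph.sym T b a) e

  E-irrefl : ∀ {a} → ¬ E T a a
  E-irrefl {a} e with () ← trans (≡.sym (irrefl T a)) e

  NonBacktracking : List V → Set
  NonBacktracking (x ∷ y ∷ z ∷ l) = x ≢ z × NonBacktracking (y ∷ z ∷ l)
  NonBacktracking _ = ⊤

  NonBacktracking-tail : ∀ x l → NonBacktracking (x ∷ l) → NonBacktracking l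
  NonBacktracking-tail _ [] _ = tt
  NonBacktracking-tail _ (_ ∷ []) _ = tt
  NonBacktracking-tail _ (_ ∷ _ ∷ _) (_ , nb) = nb

  -- Walk r a P: the list a ∷ P is a walk in T from a to r.
  Walk : V → V → List V → Set
  Walk r a P = Linked (E T) (a ∷ P) × last (a ∷ P) ≡ just r

  ReducedWalk : V → V → List V → Set
  ReducedWalk r a P = Walk r a P × NonBacktracking (a ∷ P)

  reducedWalk-tail : ∀ {r a b P} → ReducedWalk r a (b ∷ P) → ReducedWalk r b P
  reducedWalk-tail {a = a} {b} {P} ((lk , l) , nb) = (Linked.tail lk , l) , NonBacktracking-tail a (b ∷ P) nb

  closedWalk⇒cycle : ∀ {x} ys {zs} → Linked (E T) (x ∷ ys ++ x ∷ zs) →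
    NonBacktracking (x ∷ ys ++ x ∷ zs) → Unique (ys ++ x ∷ zs) → HasCycle T
  closedWalk⇒cycle [] (e ∷ _) _ _ = contradiction e E-irrefl
  closedWalk⇒cycle (_ ∷ []) _ (x≢x , _) _ = contradiction refl x≢x
  closedWalk⇒cycle {x} ys@(_ ∷ _ ∷ _) lk _ u =
    x , ys , Unique-++-∷⁻ ys u , s≤s (s≤s z≤n) , Linked-++-∷⁻ ys lk

  repeat⇒cycle : ∀ {L} → Linked (E T) L → NonBacktracking L → ¬ Unique L → HasCycle T
  repeat⇒cycle {[]} _ _ ¬u = contradiction [] ¬u
  repeat⇒cycle {x ∷ L} lk nb ¬u with unique? _≟_ L
  ... | no ¬uL = repeat⇒cycle (Linked.tail lk) (NonBacktracking-tail x L nb) ¬uL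
  ... | yes uL with _∈?_ _≟_ x L
  ...   | no x∉L = contradiction (All.¬Any⇒All¬ L x∉L ∷ uL) ¬u
  ...   | yes x∈L with ∈-∃++ x∈L
  ...     | ys , _ , refl = closedWalk⇒cycle ys lk nb uL

  HeadsDiffer : List V → List V → Set
  HeadsDiffer (x ∷ _) (y ∷ _) = x ≢ y
  HeadsDiffer _ _ = ⊤

  -- Two walks leaving q glue, through q, into the walk (q ∷ X) ʳ++ Y = reverse X ++ q ∷ Y.
  glue-Linked : ∀ {q} X {Y} → Linked (E T) (q ∷ X) → Linked (E T) (q ∷ Y) →
    Linked (E T) ((q ∷ X) ʳ++ Y)
  glue-Linked [] _ lkY = lkY
  glue-Linked (x ∷ X) (e ∷ lkX) lkY = glue-Linked X lkX (E-sym e ∷ lkY)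

  glue-NonBacktracking : ∀ {q} X {Y} → NonBacktracking (q ∷ X) → NonBacktracking (q ∷ Y) →
    HeadsDiffer X Y → NonBacktracking ((q ∷ X) ʳ++ Y)
  glue-NonBacktracking [] _ nbY _ = nbY
  glue-NonBacktracking {q} (x ∷ X) {Y} nbX nbY x≢y =
    glue-NonBacktracking X (NonBacktracking-tail q (x ∷ X) nbX) (turn Y nbY x≢y) (differ X nbX)
    where
      turn : ∀ Y → NonBacktracking (q ∷ Y) → HeadsDiffer (x ∷ X) Y → NonBacktracking (x ∷ q ∷ Y)
      turn [] _ _ = tt
      turn (_ ∷ _) nb x≢y = x≢y , nb
      differ : ∀ X → NonBacktracking (q ∷ x ∷ X) → HeadsDiffer X (q ∷ Y)
      differ [] _ = tt
      differ (_ ∷ _) (q≢z , _) = ≢-sym q≢z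

  reducedLoop⇒cycle : ∀ {r q Q} → ReducedWalk r r (q ∷ Q) → HasCycle T
  reducedLoop⇒cycle {q = q} {Q} ((lk , l) , nb) = repeat⇒cycle lk nb (∈⇒¬Unique-∷ (last-∈ (q ∷ Q) l))

  reducedWalk-unique : ¬ HasCycle T → ∀ {r a P Q} → ReducedWalk r a P → ReducedWalk r a Q → P ≡ Q
  reducedWalk-unique acyclic {P = []} {[]} _ _ = refl
  reducedWalk-unique acyclic {P = []} {_ ∷ _} ((_ , refl) , _) wQ = ⊥-elim (acyclic (reducedLoop⇒cycle wQ))
  reducedWalk-unique acyclic {P = _ ∷ _} {[]} wP ((_ , refl) , _) = ⊥-elim (acyclic (reducedLoop⇒cycle wP))
  reducedWalk-unique acyclic {P = p ∷ P} {q ∷ Q} wP wQ with p ≟ q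
  ... | yes refl = cong (p ∷_) (reducedWalk-unique acyclic (reducedWalk-tail wP) (reducedWalk-tail wQ))
  ... | no p≢q with wP | wQ
  ...   | (lkP , lastP) , nbP | (lkQ , lastQ) , nbQ = ⊥-elim (acyclic (repeat⇒cycle
          (glue-Linked (q ∷ Q) lkQ lkP)
          (glue-NonBacktracking (q ∷ Q) nbQ nbP (≢-sym p≢q))
          (ʳ++-common⇒¬Unique (q ∷ Q) (last-∈ (q ∷ Q) lastQ) (there (last-∈ (p ∷ P) lastP)))))

  reducedWalk-step : ∀ {r a b P} → ReducedWalk r a P → E T a b →
    ReducedWalk r b (a ∷ P) ⊎ ∃ λ Q → P ≡ b ∷ Q
  reducedWalk-step {P = []} ((lk , l) , _) e = inj₁ ((E-sym e ∷ lk , l) , tt)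
  reducedWalk-step {b = b} {c ∷ P} ((lk , l) , nb) e with b ≟ c
  ... | yes refl = inj₂ (P , refl)
  ... | no b≢c = inj₁ ((E-sym e ∷ lk , l) , b≢c , nb)

  reducedWalk-along : ∀ {r a b} → Star (E T) a b → ∃ (ReducedWalk r a) → ∃ (ReducedWalk r b)
  reducedWalk-along ε w = w
  reducedWalk-along (e ◅ es) (P , w) with reducedWalk-step w e
  ... | inj₁ w′ = reducedWalk-along es (_ , w′)
  ... | inj₂ (Q , refl) = reducedWalk-along es (Q , reducedWalk-tail w)

  module Routes (tree : IsTree T) (r : V) where

    private
      reducedWalk-to : ∀ a → ∃ (ReducedWalk r a)
      reducedWalk-to a = reducedWalk-along (proj₁ tree r a) ([] , ([-] , refl) , tt)

    route : V → List V
    route a = proj₁ (reducedWalk-to a)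

    route-reduced : ∀ a → ReducedWalk r a (route a)
    route-reduced a = proj₂ (reducedWalk-to a)

    route-unique : ∀ {a P} → ReducedWalk r a P → route a ≡ P
    route-unique = reducedWalk-unique (proj₂ tree) (route-reduced _)

    route-root : route r ≡ []
    route-root = route-unique (([-] , refl) , tt)

    route-child : ∀ {b} → E T r b → route b ≡ [ r ]
    route-child e = route-unique ((E-sym e ∷ [-] , refl) , tt)

    route-edge : ∀ {a b} → E T a b → route b ≡ a ∷ route a ⊎ route a ≡ b ∷ route b
    route-edge {a} {b} e with reducedWalk-step (route-reduced a) e
    ... | inj₁ w = inj₁ (route-unique w)
    ... | inj₂ (Q , eq) = inj₂ (trans eq (cong (b ∷_) (≡.sym (route-unique tail))))
      where
        tail : ReducedWalk r b Q
        tail = reducedWalk-tail (subst (ReducedWalk r a) eq (route-reduced a))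

module _ {C : Set} (G T : Graph C) where

  open ReducedWalks T using (Walk; E-sym; module Routes)

  Neighbour : Sub G → Fin (n T) → Fin (n G) → Fin (n G) → Set
  Neighbour H b x y = vs H y ≡ true × es H x y ≡ true × col G y ≡ col T b

  record NeighbourChoice (H : Sub G) : Set where
    field
      next : Fin (n G) → Fin (n T) → Fin (n G)
      next-neighbour : ∀ {x a b} → vs H x ≡ true → col G x ≡ col T a → adj T a b ≡ true →
        Neighbour H b x (next x b)

  open NeighbourChoice

  prefer : ∀ {H} → NeighbourChoice H → ∀ {u b v} → Neighbour H b u v → NeighbourChoice H
  prefer {H} choice {u} {b} {v} uv = record { next = next′ ; next-neighbour = next′-neighbour }
    where
      next′ : Fin (n G) → Fin (n T) → Fin (n G)
      next′ x c with x ≟ u | c ≟ b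
      ... | yes _ | yes _ = v
      ... | _ | _ = next choice x c
      next′-neighbour : ∀ {x a c} → vs H x ≡ true → col G x ≡ col T a → adj T a c ≡ true →
        Neighbour H c x (next′ x c)
      next′-neighbour {x} {a} {c} x∈H x-col ac with x ≟ u | c ≟ b
      ... | yes refl | yes refl = uv
      ... | yes _ | no _ = next-neighbour choice x∈H x-col ac
      ... | no _ | _ = next-neighbour choice x∈H x-col ac

  prefer-next : ∀ {H} (choice : NeighbourChoice H) {u b v} (uv : Neighbour H b u v) →
    next (prefer choice uv) u b ≡ v
  prefer-next choice {u} {b} uv with u ≟ u | b ≟ b
  ... | yes _ | yes _ = refl
  ... | no u≢u | _ = contradiction refl u≢u
  ... | yes _ | no b≢b = contradiction refl b≢b

  module Embedding (tree : IsTree T) {H : Sub G} (H-sym : ∀ x y → es H x y ≡ es H y x)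
      (choice : NeighbourChoice H) (r : Fin (n T)) {u : Fin (n G)}
      (u∈H : vs H u ≡ true) (u-col : col G u ≡ col T r) where

    open Routes tree r

    walkImage : Fin (n T) → List (Fin (n T)) → Fin (n G)
    walkImage a [] = u
    walkImage a (b ∷ P) = next choice (walkImage b P) a

    walkImage-coloured : ∀ {a P} → Walk r a P →
      vs H (walkImage a P) ≡ true × col G (walkImage a P) ≡ col T a
    walkImage-coloured {P = []} (_ , refl) = u∈H , u-col
    walkImage-coloured {P = b ∷ P} (e ∷ lk , l) with walkImage-coloured (lk , l)
    ... | b∈H , b-col with next-neighbour choice b∈H b-col (E-sym e)
    ...   | a∈H , _ , a-col = a∈H , a-col

    walkImage-step : ∀ {a b P} → Walk r a P → adj T a b ≡ true →
      es H (walkImage a P) (walkImage b (a ∷ P)) ≡ true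
    walkImage-step w e with walkImage-coloured w
    ... | a∈H , a-col = proj₁ (proj₂ (next-neighbour choice a∈H a-col e))

    embed : Fin (n T) → Fin (n G)
    embed a = walkImage a (route a)

    embed-coloured : ∀ a → vs H (embed a) ≡ true × col G (embed a) ≡ col T a
    embed-coloured a = walkImage-coloured (proj₁ (route-reduced a))

    embed-edge : ∀ {a b} → adj T a b ≡ true → es H (embed a) (embed b) ≡ true
    embed-edge {a} {b} e with route-edge e
    ... | inj₁ eq rewrite eq = walkImage-step (proj₁ (route-reduced a)) e
    ... | inj₂ eq rewrite eq =
      trans (H-sym _ _) (walkImage-step (proj₁ (route-reduced b)) (E-sym e))

    embed-root : embed r ≡ u
    embed-root = cong (walkImage r) route-root

    embed-child : ∀ {b} → adj T r b ≡ true → embed b ≡ next choice u b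
    embed-child e = cong (walkImage _) (route-child e)

  module Image (colorful : Colorful T) {H : Sub G} (H-sub : IsSubgraph G H)
      (f : Fin (n T) → Fin (n G))
      (f-coloured : ∀ a → vs H (f a) ≡ true × col G (f a) ≡ col T a)
      (f-edge : ∀ {a b} → adj T a b ≡ true → es H (f a) (f b) ≡ true) where

    f-injective : Injective _≡_ _≡_ f
    f-injective {a} {b} eq =
      colorful (trans (≡.sym (proj₂ (f-coloured a))) (trans (cong (col G) eq) (proj₂ (f-coloured b))))

    ImageEdge : Fin (n G) → Fin (n G) → Set
    ImageEdge x y = ∃₂ λ a b → f a ≡ x × f b ≡ y × adj T a b ≡ true

    inImage? : ∀ x → Dec (∃ λ a → f a ≡ x)
    inImage? x = any? λ a → f a ≟ x

    imageEdge? : ∀ x y → Dec (ImageEdge x y)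
    imageEdge? x y = any? λ a → any? λ b → (f a ≟ x) ×-dec (f b ≟ y) ×-dec (adj T a b ≟ᵇ true)

    image : Sub G
    image = sub (λ x → ⌊ inImage? x ⌋) (λ x y → ⌊ imageEdge? x y ⌋)

    f∈image : ∀ a → vs image (f a) ≡ true
    f∈image a = ⌊⌋-true⁺ (inImage? (f a)) (a , refl)

    edge∈image : ∀ {a b} → adj T a b ≡ true → es image (f a) (f b) ≡ true
    edge∈image {a} {b} e = ⌊⌋-true⁺ (imageEdge? (f a) (f b)) (a , b , refl , refl , e)

    image-isSubgraph : IsSubgraph G image
    image-isSubgraph = edge⇒adj , edge-sym , edge⇒ends
      where
        flip-edge : ∀ {x y} → ImageEdge x y → ImageEdge y x
        flip-edge (a , b , fa , fb , e) = b , a , fb , fa , E-sym e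
        edge⇒adj : ∀ x y → es image x y ≡ true → adj G x y ≡ true
        edge⇒adj x y p with ⌊⌋-true⁻ (imageEdge? x y) p
        ... | a , b , refl , refl , e = proj₁ H-sub (f a) (f b) (f-edge e)
        edge-sym : ∀ x y → es image x y ≡ es image y x
        edge-sym x y = ⌊⌋-⇔ (mk⇔ flip-edge flip-edge) (imageEdge? x y) (imageEdge? y x)
        edge⇒ends : ∀ x y → es image x y ≡ true → vs image x ≡ true × vs image y ≡ true
        edge⇒ends x y p with ⌊⌋-true⁻ (imageEdge? x y) p
        ... | a , b , refl , refl , _ = f∈image a , f∈image b

    image-adj : ∀ a b → es image (f a) (f b) ≡ adj T a b
    image-adj a b with adj T a b in e
    ... | true = edge∈image e
    ... | false = ⌊⌋-false⁺ (imageEdge? (f a) (f b)) no-edge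
      where
        no-edge : ¬ ImageEdge (f a) (f b)
        no-edge (a′ , b′ , fa′ , fb′ , e′)
          with () ← trans (≡.sym e)
                      (subst₂ (λ x y → adj T x y ≡ true) (f-injective fa′) (f-injective fb′) e′)

    image-iso : ColorIso G image T
    image-iso = record
      { to = f
      ; to-in = f∈image
      ; from = λ x p → proj₁ (⌊⌋-true⁻ (inImage? x) p)
      ; from-to = λ a → f-injective (proj₂ (⌊⌋-true⁻ (inImage? (f a)) (f∈image a)))
      ; to-from = λ x p → proj₂ (⌊⌋-true⁻ (inImage? x) p)
      ; col-pres = λ a → proj₂ (f-coloured a)
      ; adj-pres = image-adj
      }

    image⊆H : image ⊆ₛ H
    image⊆H = vertex⊆ , edge⊆
      where
        vertex⊆ : ∀ x → vs image x ≡ true → vs H x ≡ true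
        vertex⊆ x p with ⌊⌋-true⁻ (inImage? x) p
        ... | a , refl = proj₁ (f-coloured a)
        edge⊆ : ∀ x y → es image x y ≡ true → es H x y ≡ true
        edge⊆ x y p with ⌊⌋-true⁻ (imageEdge? x y) p
        ... | a , b , refl , refl , e = f-edge e

  CopyIn : Sub G → (Sub G → Set) → Set
  CopyIn H P = Σ (Sub G) λ S → IsCopy G T S × S ⊆ₛ H × P S

  module _ (colorful : Colorful T) (tree : IsTree T) {H : Sub G} (H-sub : IsSubgraph G H) where

    rootedCopy : (choice : NeighbourChoice H) → ∀ {u r} → vs H u ≡ true → col G u ≡ col T r →
      CopyIn H λ S → vs S u ≡ true × (∀ {b} → adj T r b ≡ true → es S u (next choice u b) ≡ true)
    rootedCopy choice {u} {r} u∈H u-col =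
      image , (image-isSubgraph , image-iso) , image⊆H ,
      subst (λ x → vs image x ≡ true) embed-root (f∈image r) ,
      λ e → subst₂ (λ x y → es image x y ≡ true) embed-root (embed-child e) (edge∈image e)
      where
        open Embedding tree (proj₁ (proj₂ H-sub)) choice r u∈H u-col
        open Image colorful H-sub embed embed-coloured embed-edge

    copy-through-vertex : NeighbourChoice H → ∀ {u r} → vs H u ≡ true → col G u ≡ col T r →
      CopyIn H λ S → vs S u ≡ true
    copy-through-vertex choice u∈H u-col with rootedCopy choice u∈H u-col
    ... | S , copy , S⊆H , u∈S , _ = S , copy , S⊆H , u∈S

    copy-through-edge : NeighbourChoice H → ∀ {u v w w′} → es H u v ≡ true →
      adj T w w′ ≡ true → col G u ≡ col T w → col G v ≡ col T w′ → CopyIn H λ S → es S u v ≡ true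
    copy-through-edge choice {u} {v} uv ww′ u-col v-col
      with ends ← proj₂ (proj₂ H-sub) u v uv
      with rootedCopy (prefer choice (proj₂ ends , uv , v-col)) (proj₁ ends) u-col
    ... | S , copy , S⊆H , _ , child-edges =
      S , copy , S⊆H ,
      subst (λ y → es S u y ≡ true) (prefer-next choice (proj₂ ends , uv , v-col)) (child-edges ww′)

⊆ₛ-trans : ∀ {C} {G : Graph C} {S H K : Sub G} → S ⊆ₛ H → H ⊆ₛ K → S ⊆ₛ K
⊆ₛ-trans (S⊆Hᵛ , S⊆Hᵉ) (H⊆Kᵛ , H⊆Kᵉ) = (λ x p → H⊆Kᵛ x (S⊆Hᵛ x p)) , (λ x y p → H⊆Kᵉ x y (S⊆Hᵉ x y p))

module Algorithm {C : Set} (_≟C_ : DecidableEquality C) (G T : Graph C) where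

  private
    pruned : Sub G
    pruned = prune _≟C_ G T

    delete′ : Sub G → Fin (n G) → Sub G
    delete′ = delete _≟C_ G T

    Removable′ : Sub G → Fin (n G) → Set
    Removable′ = Removable _≟C_ G T

  ColourInT : Fin (n G) → Set
  ColourInT x = ∃ λ w → col G x ≡ col T w

  EdgeColoursInT : Fin (n G) → Fin (n G) → Set
  EdgeColoursInT x y = ∃₂ λ w w′ → adj T w w′ ≡ true × col G x ≡ col T w × col G y ≡ col T w′

  edgeColoursInT? : ∀ x y → Dec (EdgeColoursInT x y)
  edgeColoursInT? x y = any? λ w → any? λ w′ →
    (adj T w w′ ≟ᵇ true) ×-dec (col G x ≟C col T w) ×-dec (col G y ≟C col T w′)

  pruned-vertex : ∀ {x} → vs pruned x ≡ true → ColourInT x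
  pruned-vertex {x} = ⌊⌋-true⁻ (any? λ w → col G x ≟C col T w)

  pruned-edge : ∀ {x y} → es pruned x y ≡ true → EdgeColoursInT x y
  pruned-edge {x} {y} p with ∧-true⁻ (adj G x y) p
  ... | _ , q with ∧-true⁻ (pruneV _≟C_ G T x) q
  ...   | _ , q′ with ∧-true⁻ (pruneV _≟C_ G T y) q′
  ...     | _ , colours = ⌊⌋-true⁻ (edgeColoursInT? x y) colours

  pruned-isSubgraph : IsSubgraph G pruned
  pruned-isSubgraph = edge⇒adj , edge-sym , edge⇒ends
    where
      open ≡.≡-Reasoning
      edge⇒adj : ∀ x y → es pruned x y ≡ true → adj G x y ≡ true
      edge⇒adj x y p = proj₁ (∧-true⁻ (adj G x y) p)
      flip-colours : ∀ {x y} → EdgeColoursInT x y → EdgeColoursInT y x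
      flip-colours (w , w′ , ww′ , x-col , y-col) = w′ , w , trans (Graph.sym T w′ w) ww′ , y-col , x-col
      edge-sym : ∀ x y → es pruned x y ≡ es pruned y x
      edge-sym x y = let pv = pruneV _≟C_ G T in begin
        adj G x y ∧ pv x ∧ pv y ∧ ⌊ edgeColoursInT? x y ⌋
          ≡⟨ cong₂ (λ a c → a ∧ pv x ∧ pv y ∧ c) (Graph.sym G x y)
               (⌊⌋-⇔ (mk⇔ flip-colours flip-colours) (edgeColoursInT? x y) (edgeColoursInT? y x)) ⟩
        adj G y x ∧ pv x ∧ pv y ∧ ⌊ edgeColoursInT? y x ⌋
          ≡⟨ cong (adj G y x ∧_) (x∙yz≈y∙xz (pv x) (pv y) _) ⟩
        adj G y x ∧ pv y ∧ pv x ∧ ⌊ edgeColoursInT? y x ⌋ ∎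
      edge⇒ends : ∀ x y → es pruned x y ≡ true → vs pruned x ≡ true × vs pruned y ≡ true
      edge⇒ends x y p with ∧-true⁻ (adj G x y) p
      ... | _ , q with ∧-true⁻ (pruneV _≟C_ G T x) q
      ...   | x∈ , q′ = x∈ , proj₁ (∧-true⁻ (pruneV _≟C_ G T y) q′)

  copy⊆pruned : ∀ {S} → IsCopy G T S → S ⊆ₛ pruned
  copy⊆pruned {S} (S-sub , iso) = vertex⊆ , edge⊆
    where
      open ColorIso iso
      colour : ∀ x (p : vs S x ≡ true) → col G x ≡ col T (from x p)
      colour x p = trans (cong (col G) (≡.sym (to-from x p))) (col-pres (from x p))
      vertex⊆ : ∀ x → vs S x ≡ true → vs pruned x ≡ true
      vertex⊆ x p = ⌊⌋-true⁺ (any? λ w → col G x ≟C col T w) (from x p , colour x p)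
      edge⊆ : ∀ x y → es S x y ≡ true → es pruned x y ≡ true
      edge⊆ x y p =
        ∧-true⁺ (proj₁ S-sub x y p) (∧-true⁺ (vertex⊆ x x∈S) (∧-true⁺ (vertex⊆ y y∈S)
          (⌊⌋-true⁺ (edgeColoursInT? x y) (from x x∈S , from y y∈S , adj-from , colour x x∈S , colour y y∈S))))
        where
          x∈S = proj₁ (proj₂ (proj₂ S-sub) x y p)
          y∈S = proj₂ (proj₂ (proj₂ S-sub) x y p)
          adj-from : adj T (from x x∈S) (from y y∈S) ≡ true
          adj-from = trans (≡.sym (adj-pres (from x x∈S) (from y y∈S)))
            (subst₂ (λ a b → es S a b ≡ true) (≡.sym (to-from x x∈S)) (≡.sym (to-from y y∈S)) p)

  ≢⇒not⌊≟⌋ : ∀ {x v : Fin (n G)} → x ≢ v → not ⌊ x ≟ v ⌋ ≡ true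
  ≢⇒not⌊≟⌋ {x} {v} x≢v = cong not (⌊⌋-false⁺ (x ≟ v) x≢v)

  delete-isSubgraph : ∀ {H} v → IsSubgraph G H → IsSubgraph G (delete′ H v)
  delete-isSubgraph {H} v (edge⇒adj , edge-sym , edge⇒ends) = edge⇒adj′ , edge-sym′ , edge⇒ends′
    where
      edge⇒adj′ : ∀ x y → es (delete′ H v) x y ≡ true → adj G x y ≡ true
      edge⇒adj′ x y p = edge⇒adj x y (proj₁ (∧-true⁻ (es H x y) p))
      edge-sym′ : ∀ x y → es (delete′ H v) x y ≡ es (delete′ H v) y x
      edge-sym′ x y = cong₂ _∧_ (edge-sym x y) (∧-comm (not ⌊ x ≟ v ⌋) _)
      edge⇒ends′ : ∀ x y → es (delete′ H v) x y ≡ true →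
        vs (delete′ H v) x ≡ true × vs (delete′ H v) y ≡ true
      edge⇒ends′ x y p with ∧-true⁻ (es H x y) p
      ... | xy∈H , q with ∧-true⁻ (not ⌊ x ≟ v ⌋) q | edge⇒ends x y xy∈H
      ...   | x-kept , y-kept | x∈H , y∈H = ∧-true⁺ x∈H x-kept , ∧-true⁺ y∈H y-kept

  delete⊆ : ∀ {H} v → delete′ H v ⊆ₛ H
  delete⊆ {H} v = (λ x p → proj₁ (∧-true⁻ (vs H x) p)) , (λ x y p → proj₁ (∧-true⁻ (es H x y) p))

  ⊆-delete : ∀ {S H v} → IsSubgraph G S → S ⊆ₛ H → ¬ vs S v ≡ true → S ⊆ₛ delete′ H v
  ⊆-delete {S} {H} {v} (_ , _ , edge⇒ends) (S⊆Hᵛ , S⊆Hᵉ) v∉S = vertex⊆ , edge⊆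
    where
      kept : ∀ x → vs S x ≡ true → not ⌊ x ≟ v ⌋ ≡ true
      kept x x∈S = ≢⇒not⌊≟⌋ λ { refl → v∉S x∈S }
      vertex⊆ : ∀ x → vs S x ≡ true → vs (delete′ H v) x ≡ true
      vertex⊆ x x∈S = ∧-true⁺ (S⊆Hᵛ x x∈S) (kept x x∈S)
      edge⊆ : ∀ x y → es S x y ≡ true → es (delete′ H v) x y ≡ true
      edge⊆ x y p with edge⇒ends x y p
      ... | x∈S , y∈S = ∧-true⁺ (S⊆Hᵉ x y p) (∧-true⁺ (kept x x∈S) (kept y y∈S))

  removable∉copy : Colorful T → ∀ {S H v} → IsCopy G T S → S ⊆ₛ H → Removable′ H v → ¬ vs S v ≡ true
  removable∉copy colorful {S} {H} {v} (_ , iso) (S⊆Hᵛ , S⊆Hᵉ) (_ , w , w′ , v-col , ww′ , no-neighbour) v∈S =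
    no-neighbour (to w′) (S⊆Hᵛ (to w′) (to-in w′)) v-w′∈H (col-pres w′)
    where
      open ColorIso iso
      to-w : to w ≡ v
      to-w with from v v∈S | to-from v v∈S | col-pres (from v v∈S)
      ... | a | to-a | a-col = trans (cong to (≡.sym (colorful (trans (≡.sym a-col)
                                 (trans (cong (col G) to-a) v-col))))) to-a
      v-w′∈H : es H v (to w′) ≡ true
      v-w′∈H = S⊆Hᵉ v (to w′) (subst (λ x → es S x (to w′) ≡ true) to-w (trans (adj-pres w w′) ww′))

  record Invariant (H : Sub G) : Set where
    field
      isSubgraph : IsSubgraph G H
      ⊆pruned : H ⊆ₛ pruned
      copies⊆ : ∀ S → IsCopy G T S → S ⊆ₛ H

  invariant-pruned : Invariant pruned
  invariant-pruned = record
    { isSubgraph = pruned-isSubgraph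
    ; ⊆pruned = (λ _ p → p) , (λ _ _ p → p)
    ; copies⊆ = λ _ → copy⊆pruned
    }

  invariant-run : Colorful T → ∀ {H H′} → Star (Step _≟C_ G T) H H′ → Invariant H → Invariant H′
  invariant-run _ ε inv = inv
  invariant-run colorful ((v , removable , refl) ◅ run) inv = invariant-run colorful run record
    { isSubgraph = delete-isSubgraph v isSubgraph
    ; ⊆pruned = ⊆ₛ-trans {G = G} (delete⊆ v) ⊆pruned
    ; copies⊆ = λ S copy →
        ⊆-delete (proj₁ copy) (copies⊆ S copy) (removable∉copy colorful copy (copies⊆ S copy) removable)
    }
    where open Invariant inv

  stable-choice : ∀ {H} → (∀ v → ¬ Removable′ H v) → NeighbourChoice G T H
  stable-choice {H} stable = record
    { next = λ x b → choose (neighbour? x b)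
    ; next-neighbour = λ x∈H x-col ab → chosen x∈H x-col ab (neighbour? _ _)
    }
    where
      neighbour? : ∀ x b → Dec (∃ (Neighbour G T H b x))
      neighbour? x b = any? λ y → (vs H y ≟ᵇ true) ×-dec (es H x y ≟ᵇ true) ×-dec (col G y ≟C col T b)
      choose : ∀ {x b} → Dec (∃ (Neighbour G T H b x)) → Fin (n G)
      choose (yes (y , _)) = y
      choose {x} (no _) = x
      chosen : ∀ {x a b} → vs H x ≡ true → col G x ≡ col T a → adj T a b ≡ true →
        (d : Dec (∃ (Neighbour G T H b x))) → Neighbour G T H b x (choose d)
      chosen _ _ _ (yes (_ , y-neighbour)) = y-neighbour
      chosen {x} {a} {b} x∈H x-col ab (no ¬neighbour) = contradiction
        (x∈H , a , b , x-col , ab , λ y y∈H xy y-col → ¬neighbour (y , y∈H , xy , y-col))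
        (stable x)

  stable-clean : Colorful T → IsTree T → ∀ {H} → Invariant H → (∀ v → ¬ Removable′ H v) → Clean G T H
  stable-clean colorful tree {H} inv stable = clean-vertex , clean-edge
    where
      open Invariant inv
      clean-vertex : ∀ v → vs H v ≡ true → CopyIn G T H λ S → vs S v ≡ true
      clean-vertex v v∈H with pruned-vertex (proj₁ ⊆pruned v v∈H)
      ... | _ , v-col = copy-through-vertex G T colorful tree isSubgraph (stable-choice stable) v∈H v-col
      clean-edge : ∀ u v → es H u v ≡ true → CopyIn G T H λ S → es S u v ≡ true
      clean-edge u v uv with pruned-edge (proj₂ ⊆pruned u v uv)
      ... | _ , _ , ww′ , u-col , v-col =
        copy-through-edge G T colorful tree isSubgraph (stable-choice stable) uv ww′ u-col v-col

theorem7 : {C : Set} (_≟C_ : DecidableEquality C) (G T : Graph C) →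
    Colorful T → IsTree T →
    (H : Sub G) → MCG _≟C_ G T H → MaxClean G T H
theorem7 _≟C_ G T colorful tree H (run , stable) =
  isSubgraph , stable-clean colorful tree inv stable , copies⊆
  where
    open Algorithm _≟C_ G T
    inv : Invariant H
    inv = invariant-run colorful run invariant-pruned
    open Invariant inv
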